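{- Let $b\geq 2$ be an integer. Then: (1) There exists an oasis base $b$. (2) If $b$ is odd, then every $k$-oasis base $b$ has $k=1$. (3) If $b\geq 6$ is even, then there exists a $5$-oasis base $b$.
   Context: For integers $c\geq 0$ and $b\geq 2$, the augmented generalized happy function $S_{[c,b]}:\mathbb{Z}^+\to\mathbb{Z}^+$ is defined by $S_{[c,b]}\left(\sum_{i=0}^n a_i b^i\right)=c+\sum_{i=0}^n a_i^2$, where $0\le a_i\le b-1$, $a_n\neq 0$ (the base $b$ expansion). A positive integer $a$ is a fixed point of $S_{[c,b]}$ if $S_{[c,b]}(a)=a$. For $b\geq 2$ and $k\in\mathbb{Z}^+$, a $k$-oasis base $b$ is a set of $k$ consecutive non-negative integers $c$ such that for each of them $S_{[c,b]}$ has at least one fixed point; its length is $k$. An oasis base $b$ is a $k$-oasis base $b$ for some $k\geq 1$. -}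

module Defs where

open import Data.Nat using (ℕ; zero; suc; _+_; _*_; _<_; _≤_; _/_; _%_)
open import Data.Product using (Σ; ∃; _×_)
open import Relation.Binary.PropositionalEquality using (_≡_)

-- Sum of the squares of the base-(suc b) digits of n, computed with fuel.
-- Fuel n suffices since n / (suc b) < n for n > 0 when suc b ≥ 2.
digitSqSumFuel : ℕ → ℕ → ℕ → ℕ
digitSqSumFuel zero    b n = 0
digitSqSumFuel (suc f) b n = (n % suc b) * (n % suc b) + digitSqSumFuel f b (n / suc b)

-- sum of squares of base-b digits of n (junk value 0 for b = 0; only used for b ≥ 2)
digitSqSum : (b : ℕ) → ℕ → ℕ
digitSqSum zero    n = 0
digitSqSum (suc b) n = digitSqSumFuel n b n

S : (c b : ℕ) → ℕ → ℕ
S c b n = c + digitSqSum b n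

HasFixedPoint : (c b : ℕ) → Set
HasFixedPoint c b = ∃ λ a → (0 < a) × (S c b a ≡ a)

IsKOasis : (b k c₀ : ℕ) → Set
IsKOasis b k c₀ = (1 ≤ k) × (∀ i → i < k → HasFixedPoint (c₀ + i) b)

OasisExists : ℕ → Set
OasisExists b = ∃ λ k → ∃ λ c₀ → IsKOasis b k c₀

{-# OPTIONS --safe #-}
module Submission where

-- Part (1): 1 is a fixed point of S_[0,b].
-- Part (2): for odd b, n ≡ Σ aᵢ ≡ Σ aᵢ² (mod 2), so S_[c,b](a) = a forces c to be even, and two
-- consecutive c cannot both be even.
-- Part (3): for b = 2m with m ≥ 3, the two-digit numbers (m−2)b, (m−1)b+2, mb+2, (m−1)b and mb are
-- fixed points of S_[c,b] for c = m²−4, m²−3, m²−2, m²−1 and m² respectively.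

open import Defs
open import Data.Nat using (ℕ; NonZero; zero; suc; _+_; _*_; _<_; _≤_; _/_; _%_; z≤n; s≤s; parity)
open import Data.Nat.Properties
  using (+-identityʳ; ≤-trans; ≤-pred; m≤n+m; m≤n*m; m<m*n; +-monoˡ-≤; ≤-<-trans; <-≤-trans; ≤-refl)
open import Data.Nat.DivMod
  using (m≡m%n+[m/n]*n; m<n⇒m%n≡m; m<n⇒m/n≡0; [m+kn]%n≡m%n; +-distrib-/-∣ʳ; m*n/n≡m; m/n<m)
open import Data.Nat.Divisibility using (_∣_; divides-refl; _∣0; n∣m*n; ∣-refl; ∣m∣n⇒∣m+n)
open import Data.Nat.Tactic.RingSolver using (solve-∀)
open import Data.Parity using (0ℙ; 1ℙ)
import Data.Parity.Base as ℙ
open import Data.Parity.Properties using (+-homo-+; *-homo-*; *-idem; *-identityʳ; +-cancelʳ-≡; +-cancelˡ-≡)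
open import Data.Product using (∃; _×_; _,_)
open import Relation.Binary.PropositionalEquality using (_≡_; refl; sym; trans; cong; cong₂; module ≡-Reasoning)
open import Relation.Nullary using (¬_; contradiction)

parity≡0ℙ⇒2∣ : ∀ n → parity n ≡ 0ℙ → 2 ∣ n
parity≡0ℙ⇒2∣ zero          _    = 2 ∣0
parity≡0ℙ⇒2∣ (suc (suc n)) even = ∣m∣n⇒∣m+n ∣-refl (parity≡0ℙ⇒2∣ n even)

¬2∣⇒parity≡1ℙ : ∀ n → ¬ (2 ∣ n) → parity n ≡ 1ℙ
¬2∣⇒parity≡1ℙ n 2∤n with parity n in eq
... | 0ℙ = contradiction (parity≡0ℙ⇒2∣ n eq) 2∤n
... | 1ℙ = refl

parity[n*n]≡parity[n] : ∀ n → parity (n * n) ≡ parity n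
parity[n*n]≡parity[n] n = trans (*-homo-* n n) (*-idem (parity n))

parity[m*n]≡parity[m] : ∀ m {n} → parity n ≡ 1ℙ → parity (m * n) ≡ parity m
parity[m*n]≡parity[m] m {n} odd =
  trans (*-homo-* m n) (trans (cong (parity m ℙ.*_) odd) (*-identityʳ (parity m)))

digitSqSumFuel-zero : ∀ f b → digitSqSumFuel f b 0 ≡ 0
digitSqSumFuel-zero zero    b = refl
digitSqSumFuel-zero (suc f) b = digitSqSumFuel-zero f b

digitSqSumFuel-digit : ∀ f b {x} → x < suc b → digitSqSumFuel (suc f) b x ≡ x * x
digitSqSumFuel-digit f b {x} x<d = begin
  (x % suc b) * (x % suc b) + digitSqSumFuel f b (x / suc b)
    ≡⟨ cong₂ (λ r q → r * r + digitSqSumFuel f b q) (m<n⇒m%n≡m x<d) (m<n⇒m/n≡0 x<d) ⟩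
  x * x + digitSqSumFuel f b 0
    ≡⟨ cong (x * x +_) (digitSqSumFuel-zero f b) ⟩
  x * x + 0
    ≡⟨ +-identityʳ (x * x) ⟩
  x * x ∎
  where open ≡-Reasoning

digitSqSumFuel-twoDigit : ∀ {f} b {x y} → 2 ≤ f → x < suc b → y < suc b →
                          digitSqSumFuel f b (y + x * suc b) ≡ y * y + x * x
digitSqSumFuel-twoDigit {suc (suc f)} b {x} {y} (s≤s (s≤s _)) x<d y<d = begin
  (n % d) * (n % d) + digitSqSumFuel (suc f) b (n / d)
    ≡⟨ cong₂ (λ r q → r * r + digitSqSumFuel (suc f) b q) lowDigit highDigit ⟩
  y * y + digitSqSumFuel (suc f) b x
    ≡⟨ cong (y * y +_) (digitSqSumFuel-digit f b x<d) ⟩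
  y * y + x * x ∎
  where
  open ≡-Reasoning
  d = suc b
  n = y + x * d
  lowDigit : n % d ≡ y
  lowDigit = trans ([m+kn]%n≡m%n y x d) (m<n⇒m%n≡m y<d)
  highDigit : n / d ≡ x
  highDigit = trans (+-distrib-/-∣ʳ y (n∣m*n x)) (cong₂ _+_ (m<n⇒m/n≡0 y<d) (m*n/n≡m x d))

twoDigit-fixedPoint : ∀ {c b} x y → 0 < x → x < b → y < b →
                      c + (y * y + x * x) ≡ y + x * b → HasFixedPoint c b
twoDigit-fixedPoint {c} {suc b} x@(suc _) y 0<x x<d y<d eq =
  n , ≤-trans (s≤s z≤n) 2≤n , trans (cong (c +_) (digitSqSumFuel-twoDigit b 2≤n x<d y<d)) eq
  where
  n = y + x * suc b
  2≤n : 2 ≤ n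
  2≤n = ≤-trans (≤-<-trans 0<x x<d) (≤-trans (m≤n*m (suc b) x) (m≤n+m (x * suc b) y))

digitSqSumFuel-parity : ∀ b → parity (suc b) ≡ 1ℙ → 1 ≤ b →
                        ∀ f n → n ≤ f → parity (digitSqSumFuel f b n) ≡ parity n
digitSqSumFuel-parity b odd 1≤b zero    .zero z≤n = refl
digitSqSumFuel-parity b odd 1≤b (suc f) zero  _   = cong parity (digitSqSumFuel-zero (suc f) b)
digitSqSumFuel-parity b odd 1≤b (suc f) n@(suc _) (s≤s n≤f) = begin
  parity (r * r + digitSqSumFuel f b q)
    ≡⟨ +-homo-+ (r * r) _ ⟩
  parity (r * r) ℙ.+ parity (digitSqSumFuel f b q)
    ≡⟨ cong₂ ℙ._+_ (parity[n*n]≡parity[n] r) ih ⟩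
  parity r ℙ.+ parity q
    ≡⟨ cong (parity r ℙ.+_) (sym (parity[m*n]≡parity[m] q odd)) ⟩
  parity r ℙ.+ parity (q * d)
    ≡⟨ sym (+-homo-+ r (q * d)) ⟩
  parity (r + q * d)
    ≡⟨ cong parity (sym (m≡m%n+[m/n]*n n d)) ⟩
  parity n ∎
  where
  open ≡-Reasoning
  d = suc b
  r = n % d
  q = n / d
  ih : parity (digitSqSumFuel f b q) ≡ parity q
  ih = digitSqSumFuel-parity b odd 1≤b f q (≤-pred (<-≤-trans (m/n<m n d (s≤s 1≤b)) (s≤s n≤f)))

digitSqSum-parity : ∀ b → 2 ≤ b → parity b ≡ 1ℙ → ∀ n → parity (digitSqSum b n) ≡ parity n
digitSqSum-parity (suc b) (s≤s 1≤b) odd n = digitSqSumFuel-parity b odd 1≤b n n ≤-refl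

oddBase-fixedPoint-parity : ∀ {b c} → 2 ≤ b → parity b ≡ 1ℙ → HasFixedPoint c b → parity c ≡ 0ℙ
oddBase-fixedPoint-parity {b} {c} 2≤b odd (a , _ , fixed) = +-cancelʳ-≡ (parity s) (parity c) 0ℙ (begin
  parity c ℙ.+ parity s ≡⟨ sym (+-homo-+ c s) ⟩
  parity (c + s)        ≡⟨ cong parity fixed ⟩
  parity a              ≡⟨ sym (digitSqSum-parity b 2≤b odd a) ⟩
  parity s              ∎)
  where
  open ≡-Reasoning
  s = digitSqSum b a

oddBase-oasis-length≡1 : ∀ {b} → 2 ≤ b → parity b ≡ 1ℙ → ∀ k c₀ → IsKOasis b k c₀ → k ≡ 1
oddBase-oasis-length≡1 2≤b odd zero          c₀ (() , _)
oddBase-oasis-length≡1 2≤b odd (suc zero)    c₀ _ = refl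
oddBase-oasis-length≡1 2≤b odd (suc (suc k)) c₀ (_ , fixedPoint) =
  contradiction (+-cancelˡ-≡ (parity c₀) 0ℙ 1ℙ (trans (evenAt 0 (s≤s z≤n)) (sym (evenAt 1 (s≤s (s≤s z≤n))))))
    λ ()
  where
  evenAt : ∀ i → i < suc (suc k) → parity c₀ ℙ.+ parity i ≡ 0ℙ
  evenAt i i<k = trans (sym (+-homo-+ c₀ i)) (oddBase-fixedPoint-parity 2≤b odd (fixedPoint i i<k))

digit<evenBase : ∀ {m k} .{{_ : NonZero m}} → k ≤ m → k < m * 2
digit<evenBase {m} k≤m = ≤-<-trans k≤m (m<m*n m 2 (s≤s (s≤s z≤n)))

-- b = 2m with m = 3 + t, so that c₀ = (1 + t) * (5 + t) = m² − 4.
evenBase-fiveOasis : ∀ t → IsKOasis ((3 + t) * 2) 5 ((1 + t) * (5 + t))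
evenBase-fiveOasis t = s≤s z≤n , fixedPoint
  where
  m = 3 + t
  fixedAt : ∀ {c} x y → 0 < x → x ≤ m → y ≤ m →
            c + (y * y + x * x) ≡ y + x * (m * 2) → HasFixedPoint c (m * 2)
  fixedAt x y 0<x x≤m y≤m = twoDigit-fixedPoint x y 0<x (digit<evenBase x≤m) (digit<evenBase y≤m)
  offset≤ : ∀ {k} → k ≤ 3 → k + t ≤ m
  offset≤ = +-monoˡ-≤ t
  fixedPoint : ∀ i → i < 5 → HasFixedPoint ((1 + t) * (5 + t) + i) (m * 2)
  fixedPoint 0 _ = fixedAt (1 + t) 0 (s≤s z≤n) (offset≤ (s≤s z≤n)) z≤n (eq t)
    where
    eq : ∀ t → (1 + t) * (5 + t) + 0 + (0 * 0 + (1 + t) * (1 + t)) ≡ 0 + (1 + t) * ((3 + t) * 2)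
    eq = solve-∀
  fixedPoint 1 _ = fixedAt (2 + t) 2 (s≤s z≤n) (offset≤ (s≤s (s≤s z≤n))) (s≤s (s≤s z≤n)) (eq t)
    where
    eq : ∀ t → (1 + t) * (5 + t) + 1 + (2 * 2 + (2 + t) * (2 + t)) ≡ 2 + (2 + t) * ((3 + t) * 2)
    eq = solve-∀
  fixedPoint 2 _ = fixedAt (3 + t) 2 (s≤s z≤n) ≤-refl (s≤s (s≤s z≤n)) (eq t)
    where
    eq : ∀ t → (1 + t) * (5 + t) + 2 + (2 * 2 + (3 + t) * (3 + t)) ≡ 2 + (3 + t) * ((3 + t) * 2)
    eq = solve-∀
  fixedPoint 3 _ = fixedAt (2 + t) 0 (s≤s z≤n) (offset≤ (s≤s (s≤s z≤n))) z≤n (eq t)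
    where
    eq : ∀ t → (1 + t) * (5 + t) + 3 + (0 * 0 + (2 + t) * (2 + t)) ≡ 0 + (2 + t) * ((3 + t) * 2)
    eq = solve-∀
  fixedPoint 4 _ = fixedAt (3 + t) 0 (s≤s z≤n) ≤-refl z≤n (eq t)
    where
    eq : ∀ t → (1 + t) * (5 + t) + 4 + (0 * 0 + (3 + t) * (3 + t)) ≡ 0 + (3 + t) * ((3 + t) * 2)
    eq = solve-∀
  fixedPoint (suc (suc (suc (suc (suc _))))) (s≤s (s≤s (s≤s (s≤s (s≤s ())))))

evenBase-fiveOasis-exists : ∀ {b} → 6 ≤ b → 2 ∣ b → ∃ λ c₀ → IsKOasis b 5 c₀
evenBase-fiveOasis-exists {.(0 * 2)} ()                                (divides-refl 0)
evenBase-fiveOasis-exists {.(1 * 2)} (s≤s (s≤s ()))                    (divides-refl 1)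
evenBase-fiveOasis-exists {.(2 * 2)} (s≤s (s≤s (s≤s (s≤s ()))))        (divides-refl 2)
evenBase-fiveOasis-exists {.((3 + t) * 2)} _ (divides-refl (suc (suc (suc t)))) = _ , evenBase-fiveOasis t

one-isFixedPoint : ∀ {b} → 2 ≤ b → HasFixedPoint 0 b
one-isFixedPoint {suc (suc b)} (s≤s (s≤s _)) = 1 , s≤s z≤n , refl

zero-isOneOasis : ∀ {b} → 2 ≤ b → IsKOasis b 1 0
zero-isOneOasis 2≤b = s≤s z≤n , λ { zero _ → one-isFixedPoint 2≤b ; (suc _) (s≤s ()) }

theorem3 : ∀ (b : ℕ) → 2 ≤ b →
    OasisExists b
    × (¬ (2 ∣ b) → ∀ (k c₀ : ℕ) → IsKOasis b k c₀ → k ≡ 1)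
    × (6 ≤ b → 2 ∣ b → ∃ λ c₀ → IsKOasis b 5 c₀)
theorem3 b 2≤b =
    (1 , 0 , zero-isOneOasis 2≤b)
  , (λ 2∤b → oddBase-oasis-length≡1 2≤b (¬2∣⇒parity≡1ℙ b 2∤b))
  , evenBase-fiveOasis-exists
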